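{- Let $k\ge 3$ and let $G$ be an $egr(n,k,g,\lambda)$ graph with $g=2h+1$ odd. Then every vertex of $G$ is contained in at most $$\binom{k}{2}\left((k-1)^h-\frac{\lambda}{k-1}\right)$$ distinct cycles of length $g+1$.
   Context: All graphs are finite and simple; throughout, $k>2$. A graph is an $egr(n,k,g,\lambda)$ (edge-girth-regular graph) if it is $k$-regular, has $n$ vertices, has girth $g$, and every edge lies in exactly $\lambda$ distinct cycles of length $g$. -}

module Defs where

open import Data.Nat using (ℕ; zero; suc; _≤_; _<ᵇ_; _≤ᵇ_; _≡ᵇ_)
open import Data.Fin using (Fin; toℕ)
open import Data.Fin.Properties using () renaming (_≟_ to _≟F_)
open import Data.Bool using (Bool; true; false; _∧_; not; _∨_)
open import Data.List using (List; []; _∷_; length; map; concatMap; filterᵇ; allFin)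
open import Data.Product using (Σ; _×_)
open import Relation.Binary.PropositionalEquality using (_≡_)
open import Relation.Nullary.Decidable using (⌊_⌋)

record Graph (n : ℕ) : Set where
  field
    adj    : Fin n → Fin n → Bool
    sym    : ∀ u v → adj u v ≡ adj v u
    irrefl : ∀ v → adj v v ≡ false
open Graph public

module _ {n : ℕ} (G : Graph n) where

  degree : Fin n → ℕ
  degree v = length (filterᵇ (adj G v) (allFin n))

  IsRegular : ℕ → Set
  IsRegular k = ∀ v → degree v ≡ k

  elem : Fin n → List (Fin n) → Bool
  elem x []       = false
  elem x (y ∷ ys) = ⌊ x ≟F y ⌋ ∨ elem x ys

  distinct : List (Fin n) → Bool
  distinct []       = true
  distinct (x ∷ xs) = not (elem x xs) ∧ distinct xs

  consecAdj : List (Fin n) → Bool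
  consecAdj (x ∷ y ∷ rest) = adj G x y ∧ consecAdj (y ∷ rest)
  consecAdj _              = true

  lastOr : Fin n → List (Fin n) → Fin n
  lastOr d []       = d
  lastOr d (x ∷ xs) = lastOr x xs

  closes : List (Fin n) → Bool
  closes []       = false
  closes (x ∷ xs) = adj G (lastOr x xs) x

  isCycleSeq : List (Fin n) → Bool
  isCycleSeq s = (3 ≤ᵇ length s) ∧ distinct s ∧ consecAdj s ∧ closes s

  words : ℕ → List (List (Fin n))
  words zero    = [] ∷ []
  words (suc L) = concatMap (λ x → map (x ∷_) (words L)) (allFin n)

  cycleSeqs : ℕ → List (List (Fin n))
  cycleSeqs L = filterᵇ isCycleSeq (words L)

  HasGirth : ℕ → Set
  HasGirth g = Σ (List (Fin n)) (λ s → length s ≡ g × isCycleSeq s ≡ true)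
             × (∀ s → isCycleSeq s ≡ true → g ≤ length s)

  -- Each cycle of length L containing the edge uv is traced by exactly one
  -- cycle sequence starting u, v.  So this is the number of distinct
  -- L-cycles through the edge uv.
  startsWithEdge : Fin n → Fin n → List (Fin n) → Bool
  startsWithEdge u v (x ∷ y ∷ _) = ⌊ x ≟F u ⌋ ∧ ⌊ y ≟F v ⌋
  startsWithEdge u v _           = false

  edgeCycleCount : ℕ → Fin n → Fin n → ℕ
  edgeCycleCount L u v = length (filterᵇ (startsWithEdge u v) (cycleSeqs L))

  -- Each cycle of length L ≥ 3 through v is traced by exactly two cycle
  -- sequences starting at v (one per orientation); we keep the canonical one
  -- whose second vertex is smaller than its last vertex.
  canonicalAt : Fin n → List (Fin n) → Bool
  canonicalAt v (x ∷ y ∷ rest) = ⌊ x ≟F v ⌋ ∧ (toℕ y <ᵇ toℕ (lastOr y rest))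
  canonicalAt v _              = false

  vertexCycleCount : ℕ → Fin n → ℕ
  vertexCycleCount L v = length (filterᵇ (canonicalAt v) (cycleSeqs L))

  EdgeGirthRegularCount : ℕ → ℕ → Set
  EdgeGirthRegularCount g lam = ∀ u v → adj G u v ≡ true → edgeCycleCount g u v ≡ lam

  IsEGR : ℕ → ℕ → ℕ → Set
  IsEGR k g lam = IsRegular k × HasGirth g × EdgeGirthRegularCount g lam

-- Fix v and write g = 2h + 1. Read each cycle of length g or g + 1 through v as a sequence
-- v, r₁, …, r_L (one per orientation) and send it to the walk r_L, v, r₁, …, r_(h+1). This walk
-- does not backtrack, and there are at most k(k − 1)^(h+1) such walks. The map is injective:
-- two sequences with the same image agree up to r_(h+1) and end at the same vertex, and the two
-- remaining paths have total length < g, so they coincide, since two distinct paths with common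
-- ends would close a cycle shorter than the girth. If c is the number of (g + 1)-cycles through v,
-- these give 2c sequences, and since each of the k edges at v lies on λ cycles of length g, at
-- least kλ sequences have length g. Hence 2c + kλ ≤ k(k − 1)^(h+1); multiplying by (k − 1)/2
-- gives the bound.

module Submission where

open import Defs hiding (sym)

open import Data.Bool using (Bool; true; false; _∧_; not; if_then_else_; T?)
open import Data.Bool.Properties using (T-≡; ∧-zeroʳ)
open import Data.Empty using (⊥-elim)
open import Data.Fin using (Fin; zero; suc; toℕ)
open import Data.Fin.Properties using (_≟_)
open import Data.List using (List; []; _∷_; _++_; [_]; length; map; filterᵇ; tabulate; allFin; cartesianProductWith; concatMap; reverse; take)
open import Data.List.Properties using (∷-injective; ∷-injectiveˡ; ∷-injectiveʳ; ∷ʳ-injective; ++-assoc; ≡-dec; length-++; length-map; length-reverse; length-take; reverse-++; reverse-injective; unfold-reverse)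
open import Data.List.Membership.Propositional using (_∈_; _∉_)
open import Data.List.Membership.Propositional.Properties using (∈-filter⁺; ∈-filter⁻; ∈-++⁺ˡ; ∈-++⁻; ∈-∃++; ∈-allFin; ∈-map⁻; ∈-cartesianProductWith⁺; ∈-cartesianProductWith⁻)
open import Data.List.Relation.Binary.Disjoint.Propositional using (Disjoint)
open import Data.List.Relation.Unary.All using (All; []; _∷_)
import Data.List.Relation.Unary.All as All
import Data.List.Relation.Unary.All.Properties as AllP
open import Data.List.Relation.Unary.AllPairs using ([]; _∷_; head; tail)
open import Data.List.Relation.Unary.Any using (Any; here; there)
import Data.List.Relation.Unary.Any as Any
import Data.List.Relation.Unary.Any.Properties as AnyP
open import Data.List.Relation.Unary.Unique.Propositional using (Unique)
import Data.List.Relation.Unary.Unique.Propositional.Properties as Unique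
open import Data.Nat using (ℕ; zero; suc; _+_; _*_; _∸_; _^_; _≤_; _<_; z≤n; s≤s; z<s; _≤ᵇ_; _<ᵇ_)
open import Data.Nat.Properties hiding (_≟_)
open import Data.Nat.Combinatorics using (_C_; nC1≡n; nCk+nC[k+1]≡[n+1]C[k+1])
open import Data.Nat.Tactic.RingSolver using (solve-∀)
open import Data.Product using (Σ; _×_; _,_; proj₁; proj₂)
open import Data.Sum using (inj₁; inj₂)
open import Function.Base using (_∘_)
open import Function.Bundles using (Equivalence)
open import Relation.Binary.PropositionalEquality using (_≡_; _≢_; refl; sym; trans; cong; cong₂; subst; subst₂; module ≡-Reasoning)
open import Relation.Nullary using (¬_; yes; no)
open import Relation.Nullary.Decidable using (⌊_⌋)
open import Relation.Unary using (Decidable)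

open import Algebra.Properties.CommutativeMonoid.Sum +-0-commutativeMonoid
  using (sum; sum-cong-≗; ∑-distrib-+; sum-replicate-zero)

∧-true⁻ˡ : ∀ {a b} → a ∧ b ≡ true → a ≡ true
∧-true⁻ˡ {true} _ = refl

∧-true⁻ʳ : ∀ {a b} → a ∧ b ≡ true → b ≡ true
∧-true⁻ʳ {true} b≡true = b≡true

∧-true⁺ : ∀ {a b} → a ≡ true → b ≡ true → a ∧ b ≡ true
∧-true⁺ refl refl = refl

<ᵇ-asym : ∀ a b → (a <ᵇ b) ≡ true → (b <ᵇ a) ≡ false
<ᵇ-asym a b a<b with b <ᵇ a in b<a
... | false = refl
... | true  = ⊥-elim (<-asym (<ᵇ⇒< a b (Equivalence.from T-≡ a<b)) (<ᵇ⇒< b a (Equivalence.from T-≡ b<a)))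

≢⇒≟≡false : ∀ {n} {x y : Fin n} → x ≢ y → ⌊ x ≟ y ⌋ ≡ false
≢⇒≟≡false {x = x} {y} x≢y with x ≟ y
... | yes x≡y = ⊥-elim (x≢y x≡y)
... | no  _   = refl

≟≡true⇒≡ : ∀ {n} {x y : Fin n} → ⌊ x ≟ y ⌋ ≡ true → x ≡ y
≟≡true⇒≡ {x = x} {y} x≟y with x ≟ y
... | yes x≡y = x≡y

≟-suc : ∀ {n} (x y : Fin n) → ⌊ suc x ≟ suc y ⌋ ≡ ⌊ x ≟ y ⌋
≟-suc x y with x ≟ y
... | yes _ = refl
... | no  _ = refl

indicator : Bool → ℕ
indicator true  = 1
indicator false = 0

indicator-∧ˡ : ∀ a b → indicator (a ∧ b) ≤ indicator a
indicator-∧ˡ true  true  = ≤-refl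
indicator-∧ˡ true  false = z≤n
indicator-∧ˡ false b     = z≤n

count : {A : Set} → (A → Bool) → List A → ℕ
count p xs = length (filterᵇ p xs)

count-∷ : ∀ {A : Set} (p : A → Bool) x xs → count p (x ∷ xs) ≡ indicator (p x) + count p xs
count-∷ p x xs with p x
... | true  = refl
... | false = refl

count-++ : ∀ {A : Set} (p : A → Bool) xs ys → count p (xs ++ ys) ≡ count p xs + count p ys
count-++ p []       ys = refl
count-++ p (x ∷ xs) ys = begin
  count p (x ∷ xs ++ ys)                          ≡⟨ count-∷ p x (xs ++ ys) ⟩
  indicator (p x) + count p (xs ++ ys)            ≡⟨ cong (indicator (p x) +_) (count-++ p xs ys) ⟩
  indicator (p x) + (count p xs + count p ys)     ≡⟨ +-assoc (indicator (p x)) _ _ ⟨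
  indicator (p x) + count p xs + count p ys       ≡⟨ cong (_+ count p ys) (count-∷ p x xs) ⟨
  count p (x ∷ xs) + count p ys                   ∎
  where open ≡-Reasoning

count-∧ˡ : ∀ {A : Set} b (q : A → Bool) xs → count (λ x → b ∧ q x) xs ≡ (if b then count q xs else 0)
count-∧ˡ true  q xs       = refl
count-∧ˡ false q []       = refl
count-∧ˡ false q (x ∷ xs) = count-∧ˡ false q xs

count-map : ∀ {A B : Set} (p : A → Bool) (f : B → A) xs → count p (map f xs) ≡ count (λ x → p (f x)) xs
count-map p f []       = refl
count-map p f (x ∷ xs) = begin
  count p (f x ∷ map f xs)                         ≡⟨ count-∷ p (f x) (map f xs) ⟩
  indicator (p (f x)) + count p (map f xs)         ≡⟨ cong (indicator (p (f x)) +_) (count-map p f xs) ⟩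
  indicator (p (f x)) + count (λ x → p (f x)) xs   ≡⟨ count-∷ (λ x → p (f x)) x xs ⟨
  count (λ x → p (f x)) (x ∷ xs)                   ∎
  where open ≡-Reasoning

count-tabulate : ∀ {A : Set} {n} (p : A → Bool) (f : Fin n → A) →
  count p (tabulate f) ≡ sum (λ i → indicator (p (f i)))
count-tabulate {n = zero}  p f = refl
count-tabulate {n = suc n} p f =
  trans (count-∷ p (f zero) (tabulate (λ i → f (suc i))))
        (cong (indicator (p (f zero)) +_) (count-tabulate p (λ i → f (suc i))))

count-cartesianProductWith : ∀ {A B C : Set} (p : A → Bool) (f : B → C → A) {n} (g : Fin n → B) ys →
  count p (cartesianProductWith f (tabulate g) ys) ≡ sum (λ i → count (λ y → p (f (g i) y)) ys)
count-cartesianProductWith p f {zero}  g ys = refl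
count-cartesianProductWith p f {suc n} g ys =
  trans (count-++ p (map (f (g zero)) ys) (cartesianProductWith f (tabulate (λ i → g (suc i))) ys))
        (cong₂ _+_ (count-map p (f (g zero)) ys) (count-cartesianProductWith p f (λ i → g (suc i)) ys))

sum-mono-≤ : ∀ {n} {f g : Fin n → ℕ} → (∀ i → f i ≤ g i) → sum f ≤ sum g
sum-mono-≤ {zero}  f≤g = z≤n
sum-mono-≤ {suc n} f≤g = +-mono-≤ (f≤g zero) (sum-mono-≤ (λ i → f≤g (suc i)))

sum-guarded-≤ : ∀ {n} (b : Fin n → Bool) (f : Fin n → ℕ) m → (∀ i → b i ≡ true → f i ≤ m) →
  sum (λ i → if b i then f i else 0) ≤ sum (λ i → indicator (b i)) * m
sum-guarded-≤ {zero}  b f m f≤m = z≤n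
sum-guarded-≤ {suc n} b f m f≤m with b zero in b₀
... | true  = +-mono-≤ (f≤m zero b₀) rest
  where rest = sum-guarded-≤ (λ i → b (suc i)) (λ i → f (suc i)) m (λ i → f≤m (suc i))
... | false = sum-guarded-≤ (λ i → b (suc i)) (λ i → f (suc i)) m (λ i → f≤m (suc i))

sum-guarded-≥ : ∀ {n} (b : Fin n → Bool) (f : Fin n → ℕ) m → (∀ i → b i ≡ true → m ≤ f i) →
  sum (λ i → indicator (b i)) * m ≤ sum f
sum-guarded-≥ {zero}  b f m m≤f = z≤n
sum-guarded-≥ {suc n} b f m m≤f with b zero in b₀
... | true  = +-mono-≤ (m≤f zero b₀) rest
  where rest = sum-guarded-≥ (λ i → b (suc i)) (λ i → f (suc i)) m (λ i → m≤f (suc i))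
... | false = ≤-trans rest (m≤n+m _ (f zero))
  where rest = sum-guarded-≥ (λ i → b (suc i)) (λ i → f (suc i)) m (λ i → m≤f (suc i))

sum-indicator-≟ : ∀ {n} (y : Fin n) → sum (λ u → indicator ⌊ y ≟ u ⌋) ≡ 1
sum-indicator-≟ {suc n} zero    = cong suc (sum-replicate-zero n)
sum-indicator-≟ {suc n} (suc y) =
  trans (sum-cong-≗ (λ u → cong indicator (≟-suc y u))) (sum-indicator-≟ y)

sum-indicator-remove : ∀ {n} (b : Fin n → Bool) p → b p ≡ true →
  suc (sum (λ i → indicator (b i ∧ not ⌊ i ≟ p ⌋))) ≤ sum (λ i → indicator (b i))
sum-indicator-remove {suc n} b zero bp rewrite bp =
  s≤s (sum-mono-≤ (λ i → indicator-∧ˡ (b (suc i)) _))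
sum-indicator-remove {suc n} b (suc p) bp = begin
  suc (indicator (b zero ∧ true) + rest)   ≡⟨ +-suc (indicator (b zero ∧ true)) rest ⟨
  indicator (b zero ∧ true) + suc rest     ≤⟨ +-mono-≤ (indicator-∧ˡ (b zero) true) suc-rest≤ ⟩
  sum (λ i → indicator (b i))              ∎
  where
  open ≤-Reasoning
  rest = sum (λ i → indicator (b (suc i) ∧ not ⌊ suc i ≟ suc p ⌋))
  suc-rest≤ : suc rest ≤ sum (λ i → indicator (b (suc i)))
  suc-rest≤ = subst (λ r → suc r ≤ _)
    (sym (sum-cong-≗ (λ i → cong (λ c → indicator (b (suc i) ∧ not c)) (≟-suc i p))))
    (sum-indicator-remove (λ i → b (suc i)) p bp)

sum-count-≤ : ∀ {A : Set} {n} (P : Fin n → A → Bool) (Q : A → Bool) →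
  (∀ x → sum (λ i → indicator (P i x)) ≤ indicator (Q x)) →
  ∀ xs → sum (λ i → count (P i) xs) ≤ count Q xs
sum-count-≤ {n = n} P Q pointwise [] = ≤-reflexive (sum-replicate-zero n)
sum-count-≤ P Q pointwise (x ∷ xs) = begin
  sum (λ i → count (P i) (x ∷ xs))
    ≡⟨ sum-cong-≗ (λ i → count-∷ (P i) x xs) ⟩
  sum (λ i → indicator (P i x) + count (P i) xs)
    ≡⟨ ∑-distrib-+ (λ i → indicator (P i x)) (λ i → count (P i) xs) ⟩
  sum (λ i → indicator (P i x)) + sum (λ i → count (P i) xs)
    ≤⟨ +-mono-≤ (pointwise x) (sum-count-≤ P Q pointwise xs) ⟩
  indicator (Q x) + count Q xs
    ≡⟨ count-∷ Q x xs ⟨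
  count Q (x ∷ xs)
    ∎
  where open ≤-Reasoning

∈-filterᵇ⁻ : ∀ {A : Set} (p : A → Bool) xs {x} → x ∈ filterᵇ p xs → x ∈ xs × p x ≡ true
∈-filterᵇ⁻ p xs m with ∈-filter⁻ (T? ∘ p) m
... | x∈xs , px = x∈xs , Equivalence.to T-≡ px

∈-filterᵇ⁺ : ∀ {A : Set} (p : A → Bool) xs {x} → x ∈ xs → p x ≡ true → x ∈ filterᵇ p xs
∈-filterᵇ⁺ p xs x∈xs px = ∈-filter⁺ (T? ∘ p) x∈xs (Equivalence.from T-≡ px)

∈⇒length-remove : ∀ {A : Set} {x : A} {ys} → x ∈ ys →
  Σ (List A) λ zs → length ys ≡ suc (length zs) × (∀ {y} → y ∈ ys → y ≢ x → y ∈ zs)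
∈⇒length-remove {ys = y ∷ ys} (here refl) =
  ys , refl , λ { (here refl) y≢x → ⊥-elim (y≢x refl) ; (there m) _ → m }
∈⇒length-remove {ys = y ∷ ys} (there x∈ys) with ∈⇒length-remove x∈ys
... | zs , len , keep =
  y ∷ zs , cong suc len , λ { (here refl) _ → here refl ; (there m) y≢x → there (keep m y≢x) }

length-≤-injection : ∀ {A B : Set} (f : A → B) (xs : List A) (ys : List B) → Unique xs →
  (∀ {x} → x ∈ xs → f x ∈ ys) → (∀ {x x'} → x ∈ xs → x' ∈ xs → f x ≡ f x' → x ≡ x') →
  length xs ≤ length ys
length-≤-injection f []       ys _              _     _   = z≤n
length-≤-injection f (x ∷ xs) ys (x∉xs ∷ uniq) maps inj with ∈⇒length-remove (maps (here refl))
... | zs , len , keep = subst (suc (length xs) ≤_) (sym len) (s≤s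
      (length-≤-injection f xs zs uniq
        (λ m → keep (maps (there m)) (λ e → All.lookup x∉xs m (sym (inj (there m) (here refl) e))))
        (λ m m' → inj (there m) (there m'))))

module _ {A : Set} where

  Unique-++⁻ˡ : ∀ (xs : List A) {ys} → Unique (xs ++ ys) → Unique xs
  Unique-++⁻ˡ []       _              = []
  Unique-++⁻ˡ (x ∷ xs) (x∉ ∷ uniq) = AllP.++⁻ˡ xs x∉ ∷ Unique-++⁻ˡ xs uniq

  Unique-++⁻ʳ : ∀ (xs : List A) {ys} → Unique (xs ++ ys) → Unique ys
  Unique-++⁻ʳ []       uniq       = uniq
  Unique-++⁻ʳ (x ∷ xs) (_ ∷ uniq) = Unique-++⁻ʳ xs uniq

  Unique-++⇒Disjoint : ∀ (xs : List A) {ys} → Unique (xs ++ ys) → Disjoint xs ys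
  Unique-++⇒Disjoint (x ∷ xs) (x∉ ∷ _)   (here refl  , y∈ys) = All.lookup (AllP.++⁻ʳ xs x∉) y∈ys refl
  Unique-++⇒Disjoint (x ∷ xs) (_ ∷ uniq) (there y∈xs , y∈ys) = Unique-++⇒Disjoint xs uniq (y∈xs , y∈ys)

  Unique-∷ʳ⁻ : ∀ (xs : List A) y ys → Unique (xs ++ y ∷ ys) → Unique (xs ++ [ y ])
  Unique-∷ʳ⁻ xs y ys uniq = Unique-++⁻ˡ (xs ++ [ y ]) (subst Unique (sym (++-assoc xs [ y ] ys)) uniq)

  All≢-reverse : ∀ {x : A} xs → All (x ≢_) xs → All (x ≢_) (reverse xs)
  All≢-reverse xs x∉xs = AllP.¬Any⇒All¬ _ (λ x∈ → All.lookup x∉xs (AnyP.reverse⁻ x∈) refl)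

  Unique-reverse : ∀ (xs : List A) → Unique xs → Unique (reverse xs)
  Unique-reverse []       _              = []
  Unique-reverse (x ∷ xs) (x∉xs ∷ uniq) = subst Unique (sym (unfold-reverse x xs))
    (Unique.++⁺ (Unique-reverse xs uniq) ([] ∷ [])
      (λ { (x∈ , here refl) → All.lookup x∉xs (AnyP.reverse⁻ x∈) refl }))

  split-at-first : ∀ {P : A → Set} → Decidable P → ∀ xs → Any P xs →
    Σ (List A) λ pre → Σ A λ y → Σ (List A) λ post →
      xs ≡ pre ++ y ∷ post × All (¬_ ∘ P) pre × P y
  split-at-first P? (x ∷ xs) any with P? x | any
  ... | yes px | _          = [] , x , xs , refl , [] , px
  ... | no ¬px | here px    = ⊥-elim (¬px px)
  ... | no ¬px | there any′ with split-at-first P? xs any′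
  ...   | pre , y , post , xs≡ , ¬P-pre , py = x ∷ pre , y , post , cong (x ∷_) xs≡ , ¬px ∷ ¬P-pre , py

  splitAt-view : ∀ m (r : List A) → m < length r →
    Σ (List A) λ pre → Σ A λ z → Σ (List A) λ post → r ≡ pre ++ z ∷ post × length pre ≡ m
  splitAt-view zero    (z ∷ r) _        = [] , z , r , refl , refl
  splitAt-view (suc m) (x ∷ r) (s≤s m<) with splitAt-view m r m<
  ... | pre , z , post , r≡ , |pre| = x ∷ pre , z , post , cong (x ∷_) r≡ , cong suc |pre|

  take-suc-++ : ∀ {m} (pre : List A) z post → length pre ≡ m →
    take (suc m) (pre ++ z ∷ post) ≡ pre ++ [ z ]
  take-suc-++ []        z post refl = refl
  take-suc-++ (x ∷ pre) z post refl = cong (x ∷_) (take-suc-++ pre z post refl)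

concatMap-map≡cartesianProductWith : ∀ {A B C : Set} (f : A → B → C) xs ys →
  concatMap (λ x → map (f x) ys) xs ≡ cartesianProductWith f xs ys
concatMap-map≡cartesianProductWith f []       ys = refl
concatMap-map≡cartesianProductWith f (x ∷ xs) ys =
  cong (map (f x) ys ++_) (concatMap-map≡cartesianProductWith f xs ys)

module Walks {n : ℕ} (G : Graph n) where

  _~_ : Fin n → Fin n → Set
  x ~ y = adj G x y ≡ true

  ~-sym : ∀ {x y} → x ~ y → y ~ x
  ~-sym {x} {y} x~y = trans (Graph.sym G y x) x~y

  elem≡false⇒∉ : ∀ x xs → elem G x xs ≡ false → All (x ≢_) xs
  elem≡false⇒∉ x []       _ = []
  elem≡false⇒∉ x (y ∷ ys) e with x ≟ y
  ... | no x≢y = x≢y ∷ elem≡false⇒∉ x ys e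

  ∉⇒elem≡false : ∀ x xs → All (x ≢_) xs → elem G x xs ≡ false
  ∉⇒elem≡false x []       _            = refl
  ∉⇒elem≡false x (y ∷ ys) (x≢y ∷ x∉ys) with x ≟ y
  ... | yes x≡y = ⊥-elim (x≢y x≡y)
  ... | no  _   = ∉⇒elem≡false x ys x∉ys

  distinct⇒Unique : ∀ xs → distinct G xs ≡ true → Unique xs
  distinct⇒Unique []       _ = []
  distinct⇒Unique (x ∷ xs) d with elem G x xs in x∈?xs
  ... | false = elem≡false⇒∉ x xs x∈?xs ∷ distinct⇒Unique xs d

  Unique⇒distinct : ∀ xs → Unique xs → distinct G xs ≡ true
  Unique⇒distinct []       _              = refl
  Unique⇒distinct (x ∷ xs) (x∉xs ∷ uniq) rewrite ∉⇒elem≡false x xs x∉xs = Unique⇒distinct xs uniq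

  IsWalk : List (Fin n) → Set
  IsWalk xs = consecAdj G xs ≡ true

  walk-head : ∀ x y ys → IsWalk (x ∷ y ∷ ys) → x ~ y
  walk-head x y ys w = ∧-true⁻ˡ {adj G x y} w

  walk-tail : ∀ x xs → IsWalk (x ∷ xs) → IsWalk xs
  walk-tail x []       _ = refl
  walk-tail x (y ∷ xs) w = ∧-true⁻ʳ w

  walk-++ : ∀ xs y ys → IsWalk (xs ++ [ y ]) → IsWalk (y ∷ ys) → IsWalk (xs ++ y ∷ ys)
  walk-++ []            y ys _ w₂ = w₂
  walk-++ (x ∷ [])      y ys w₁ w₂ = ∧-true⁺ (∧-true⁻ˡ w₁) w₂
  walk-++ (x ∷ x′ ∷ xs) y ys w₁ w₂ = ∧-true⁺ (∧-true⁻ˡ w₁) (walk-++ (x′ ∷ xs) y ys (∧-true⁻ʳ w₁) w₂)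

  walk-++⁻ˡ : ∀ xs y ys → IsWalk (xs ++ y ∷ ys) → IsWalk (xs ++ [ y ])
  walk-++⁻ˡ []            y ys _ = refl
  walk-++⁻ˡ (x ∷ [])      y ys w = ∧-true⁺ (∧-true⁻ˡ w) refl
  walk-++⁻ˡ (x ∷ x′ ∷ xs) y ys w = ∧-true⁺ (∧-true⁻ˡ w) (walk-++⁻ˡ (x′ ∷ xs) y ys (∧-true⁻ʳ w))

  walk-++⁻ʳ : ∀ xs y ys → IsWalk (xs ++ y ∷ ys) → IsWalk (y ∷ ys)
  walk-++⁻ʳ []            y ys w = w
  walk-++⁻ʳ (x ∷ [])      y ys w = ∧-true⁻ʳ w
  walk-++⁻ʳ (x ∷ x′ ∷ xs) y ys w = walk-++⁻ʳ (x′ ∷ xs) y ys (∧-true⁻ʳ w)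

  walk-reverse : ∀ xs → IsWalk xs → IsWalk (reverse xs)
  walk-reverse []           _ = refl
  walk-reverse (x ∷ [])     _ = refl
  walk-reverse (x ∷ y ∷ xs) w = subst IsWalk (sym reverse-split)
    (walk-++ (reverse xs) y [ x ]
      (subst IsWalk (unfold-reverse y xs) (walk-reverse (y ∷ xs) (∧-true⁻ʳ w)))
      (∧-true⁺ (~-sym (∧-true⁻ˡ w)) refl))
    where
    reverse-split : reverse (x ∷ y ∷ xs) ≡ reverse xs ++ y ∷ [ x ]
    reverse-split = trans (unfold-reverse x (y ∷ xs))
      (trans (cong (_++ [ x ]) (unfold-reverse y xs)) (++-assoc (reverse xs) [ y ] [ x ]))

  walk-take : ∀ m xs → IsWalk xs → IsWalk (take m xs)
  walk-take zero          xs           _ = refl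
  walk-take (suc m)       []           _ = refl
  walk-take (suc zero)    (x ∷ xs)     _ = refl
  walk-take (suc (suc m)) (x ∷ [])     _ = refl
  walk-take (suc (suc m)) (x ∷ y ∷ xs) w =
    ∧-true⁺ (∧-true⁻ˡ w) (walk-take (suc m) (y ∷ xs) (∧-true⁻ʳ w))

  lastOr-∈ : ∀ x xs → lastOr G x xs ∈ x ∷ xs
  lastOr-∈ x []       = here refl
  lastOr-∈ x (y ∷ ys) = there (lastOr-∈ y ys)

  lastOr-++ : ∀ d xs y ys → lastOr G d (xs ++ y ∷ ys) ≡ lastOr G y ys
  lastOr-++ d []       y ys = refl
  lastOr-++ d (x ∷ xs) y ys = lastOr-++ x xs y ys

  walk-∷ʳ : ∀ y ys x → IsWalk (y ∷ ys) → lastOr G y ys ~ x → IsWalk ((y ∷ ys) ++ [ x ])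
  walk-∷ʳ y []       x _ y~x = ∧-true⁺ y~x refl
  walk-∷ʳ y (z ∷ ys) x w z~x = ∧-true⁺ (∧-true⁻ˡ w) (walk-∷ʳ z ys x (∧-true⁻ʳ w) z~x)

  record IsCycle (s : List (Fin n)) : Set where
    field
      length≥3 : 3 ≤ length s
      unique   : Unique s
      walk     : IsWalk s
      closed   : closes G s ≡ true

  isCycleSeq⇒IsCycle : ∀ s → isCycleSeq G s ≡ true → IsCycle s
  isCycleSeq⇒IsCycle s c = record
    { length≥3 = ≤ᵇ⇒≤ 3 (length s) (Equivalence.from T-≡ (∧-true⁻ˡ c))
    ; unique   = distinct⇒Unique s (∧-true⁻ˡ c₁)
    ; walk     = ∧-true⁻ˡ c₂
    ; closed   = ∧-true⁻ʳ c₂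
    }
    where
    c₁ : distinct G s ∧ consecAdj G s ∧ closes G s ≡ true
    c₁ = ∧-true⁻ʳ {3 ≤ᵇ length s} c
    c₂ : consecAdj G s ∧ closes G s ≡ true
    c₂ = ∧-true⁻ʳ {distinct G s} c₁

  IsCycle⇒isCycleSeq : ∀ s → IsCycle s → isCycleSeq G s ≡ true
  IsCycle⇒isCycleSeq s c = ∧-true⁺ (Equivalence.to T-≡ (≤⇒≤ᵇ length≥3))
    (∧-true⁺ (Unique⇒distinct s unique) (∧-true⁺ walk closed))
    where open IsCycle c

module Cycles {n : ℕ} (G : Graph n) where
  open Walks G
  open import Data.List.Membership.DecPropositional (_≟_ {n}) using (_∈?_)

  length-joined : ∀ (z : Fin n) pre y qi →
    length (z ∷ pre ++ y ∷ reverse qi) ≡ suc (length pre + suc (length qi))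
  length-joined z pre y qi =
    cong suc (trans (length-++ pre) (cong (λ l → length pre + suc l) (length-reverse qi)))

  cycle-from-internally-disjoint-paths : ∀ z pre y qi →
    IsWalk (z ∷ pre ++ [ y ]) → IsWalk (z ∷ qi ++ [ y ]) →
    Unique (z ∷ pre ++ [ y ]) → Unique (z ∷ qi ++ [ y ]) → Disjoint pre qi →
    1 ≤ length pre + length qi → IsCycle (z ∷ pre ++ y ∷ reverse qi)
  cycle-from-internally-disjoint-paths z pre y qi walk-pre walk-qi (z∉pre ∷ uniq-pre) (z∉qi ∷ uniq-qi)
    pre∩qi nonempty = record
      { length≥3 = length≥3 ; unique = z∉cycle ∷ uniq-cycle ; walk = walk-cycle ; closed = closed qi walk-qi }
    where
    y∉qi : y ∉ qi
    y∉qi y∈qi = Unique-++⇒Disjoint qi uniq-qi (y∈qi , here refl)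

    uniq-cycle : Unique (pre ++ y ∷ reverse qi)
    uniq-cycle = Unique.++⁺ (Unique-++⁻ˡ pre uniq-pre)
      (AllP.¬Any⇒All¬ _ (y∉qi ∘ AnyP.reverse⁻) ∷ Unique-reverse qi (Unique-++⁻ˡ qi uniq-qi))
      λ { (x∈pre , here refl)   → Unique-++⇒Disjoint pre uniq-pre (x∈pre , here refl)
        ; (x∈pre , there x∈qi) → pre∩qi (x∈pre , AnyP.reverse⁻ x∈qi) }

    z∉cycle : All (z ≢_) (pre ++ y ∷ reverse qi)
    z∉cycle = AllP.++⁺ (AllP.++⁻ˡ pre z∉pre)
      (All.lookup (AllP.++⁻ʳ pre z∉pre) (here refl) ∷ All≢-reverse qi (AllP.++⁻ˡ qi z∉qi))

    walk-cycle : IsWalk (z ∷ pre ++ y ∷ reverse qi)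
    walk-cycle = walk-++ (z ∷ pre) y (reverse qi) walk-pre
      (subst IsWalk (reverse-++ qi [ y ]) (walk-reverse (qi ++ [ y ]) (walk-tail z (qi ++ [ y ]) walk-qi)))

    closed : ∀ qi → IsWalk (z ∷ qi ++ [ y ]) → lastOr G z (pre ++ y ∷ reverse qi) ~ z
    closed []       w = subst (_~ z) (sym (lastOr-++ z pre y [])) (~-sym (∧-true⁻ˡ w))
    closed (q ∷ qi) w = subst (_~ z) (sym last≡q) (~-sym (∧-true⁻ˡ w))
      where
      last≡q : lastOr G z (pre ++ y ∷ reverse (q ∷ qi)) ≡ q
      last≡q = trans (lastOr-++ z pre y (reverse (q ∷ qi)))
        (trans (cong (lastOr G y) (unfold-reverse q qi)) (lastOr-++ y (reverse qi) q []))

    length≥3 : 3 ≤ length (z ∷ pre ++ y ∷ reverse qi)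
    length≥3 = subst (3 ≤_) (sym (length-joined z pre y qi))
      (s≤s (subst (2 ≤_) (sym (+-suc (length pre) (length qi))) (s≤s nonempty)))

  cycle-from-diverging-paths : ∀ z a as b bs → a ≢ b →
    Unique (z ∷ a ∷ as) → Unique (z ∷ b ∷ bs) → IsWalk (z ∷ a ∷ as) → IsWalk (z ∷ b ∷ bs) →
    lastOr G a as ≡ lastOr G b bs →
    Σ (List (Fin n)) λ s → IsCycle s × length s ≤ length (a ∷ as) + length (b ∷ bs)
  -- y is the first vertex of a ∷ as lying on b ∷ bs; the cycle runs z, pre, y and back along b ∷ bs.
  cycle-from-diverging-paths z a as b bs a≢b uniq-A uniq-B walk-A walk-B same-end
    with split-at-first (_∈? (b ∷ bs)) (a ∷ as) (Any.map end-in-B (lastOr-∈ a as))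
    where
    end-in-B : ∀ {x} → lastOr G a as ≡ x → x ∈ b ∷ bs
    end-in-B refl = subst (_∈ b ∷ bs) (sym same-end) (lastOr-∈ b bs)
  ... | pre , y , post , A≡ , pre∉B , y∈B with ∈-∃++ y∈B
  ... | qi , qpost , B≡ = z ∷ pre ++ y ∷ reverse qi , cycle , bound
    where
    cycle : IsCycle (z ∷ pre ++ y ∷ reverse qi)
    cycle = cycle-from-internally-disjoint-paths z pre y qi
      (walk-++⁻ˡ (z ∷ pre) y post (subst (λ t → IsWalk (z ∷ t)) A≡ walk-A))
      (walk-++⁻ˡ (z ∷ qi) y qpost (subst (λ t → IsWalk (z ∷ t)) B≡ walk-B))
      (Unique-∷ʳ⁻ (z ∷ pre) y post (subst (λ t → Unique (z ∷ t)) A≡ uniq-A))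
      (Unique-∷ʳ⁻ (z ∷ qi) y qpost (subst (λ t → Unique (z ∷ t)) B≡ uniq-B))
      (λ (x∈pre , x∈qi) → All.lookup pre∉B x∈pre (subst (_ ∈_) (sym B≡) (∈-++⁺ˡ x∈qi)))
      (nonempty pre qi A≡ B≡)
      where
      nonempty : ∀ pre qi → a ∷ as ≡ pre ++ y ∷ post → b ∷ bs ≡ qi ++ y ∷ qpost →
        1 ≤ length pre + length qi
      nonempty []      []      A≡ B≡ = ⊥-elim (a≢b (trans (∷-injectiveˡ A≡) (sym (∷-injectiveˡ B≡))))
      nonempty []      (_ ∷ _) _  _  = s≤s z≤n
      nonempty (_ ∷ _) _       _  _  = s≤s z≤n

    bound : length (z ∷ pre ++ y ∷ reverse qi) ≤ length (a ∷ as) + length (b ∷ bs)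
    bound = subst₂ _≤_ (sym (length-joined z pre y qi))
      (sym (cong₂ _+_ (trans (cong length A≡) (length-++ pre)) (trans (cong length B≡) (length-++ qi))))
      (+-mono-≤ (m<m+n (length pre) z<s) (m<m+n (length qi) z<s))

  cycle-from-distinct-paths : ∀ z p q →
    Unique (z ∷ p) → Unique (z ∷ q) → IsWalk (z ∷ p) → IsWalk (z ∷ q) → lastOr G z p ≡ lastOr G z q → p ≢ q →
    Σ (List (Fin n)) λ s → IsCycle s × length s ≤ length p + length q
  cycle-from-distinct-paths z []      []      _ _ _ _ _ p≢q = ⊥-elim (p≢q refl)
  cycle-from-distinct-paths z []      (b ∷ q) _ (z∉q ∷ _) _ _ z≡end _ =
    ⊥-elim (All.lookup z∉q (lastOr-∈ b q) z≡end)
  cycle-from-distinct-paths z (a ∷ p) []      (z∉p ∷ _) _ _ _ end≡z _ =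
    ⊥-elim (All.lookup z∉p (lastOr-∈ a p) (sym end≡z))
  cycle-from-distinct-paths z (a ∷ p) (b ∷ q) uniq-p uniq-q walk-p walk-q same-end p≢q with a ≟ b
  ... | no a≢b = cycle-from-diverging-paths z a p b q a≢b uniq-p uniq-q walk-p walk-q same-end
  ... | yes refl with cycle-from-distinct-paths a p q (tail uniq-p) (tail uniq-q)
                        (walk-tail z (a ∷ p) walk-p) (walk-tail z (a ∷ q) walk-q)
                        same-end (p≢q ∘ cong (a ∷_))
  ...   | s , cycle , bound = s , cycle , ≤-trans bound (+-mono-≤ (n≤1+n _) (n≤1+n _))

  GirthAtLeast : ℕ → Set
  GirthAtLeast g = ∀ s → isCycleSeq G s ≡ true → g ≤ length s

  paths-unique-below-girth : ∀ {g} → GirthAtLeast g →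
    ∀ z p q → Unique (z ∷ p) → Unique (z ∷ q) → IsWalk (z ∷ p) → IsWalk (z ∷ q) →
    lastOr G z p ≡ lastOr G z q → length p + length q < g → p ≡ q
  paths-unique-below-girth girth z p q uniq-p uniq-q walk-p walk-q same-end short with ≡-dec _≟_ p q
  ... | yes p≡q = p≡q
  ... | no  p≢q with cycle-from-distinct-paths z p q uniq-p uniq-q walk-p walk-q same-end p≢q
  ...   | s , cycle , bound = ⊥-elim (<⇒≱ short (≤-trans (girth s (IsCycle⇒isCycleSeq s cycle)) bound))

module Words {n : ℕ} (G : Graph n) where

  words-suc : ∀ L → words G (suc L) ≡ cartesianProductWith _∷_ (allFin n) (words G L)
  words-suc L = concatMap-map≡cartesianProductWith _∷_ (allFin n) (words G L)

  ∈-words⁻ : ∀ L {t} → t ∈ words G L → length t ≡ L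
  ∈-words⁻ zero    (here refl) = refl
  ∈-words⁻ (suc L) t∈
    with ∈-cartesianProductWith⁻ _∷_ (allFin n) (words G L) (subst (_ ∈_) (words-suc L) t∈)
  ... | _ , t′ , _ , t′∈ , refl = cong suc (∈-words⁻ L t′∈)

  ∈-words⁺ : ∀ t → t ∈ words G (length t)
  ∈-words⁺ []      = here refl
  ∈-words⁺ (x ∷ t) = subst (_ ∈_) (sym (words-suc (length t)))
    (∈-cartesianProductWith⁺ _∷_ (∈-allFin x) (∈-words⁺ t))

  words-unique : ∀ L → Unique (words G L)
  words-unique zero    = [] ∷ []
  words-unique (suc L) = subst Unique (sym (words-suc L))
    (Unique.cartesianProductWith⁺ _∷_ ∷-injective (Unique.allFin⁺ n) (words-unique L))

  count-words-suc : ∀ (p : List (Fin n) → Bool) L →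
    count p (words G (suc L)) ≡ sum (λ x → count (λ t → p (x ∷ t)) (words G L))
  count-words-suc p L =
    trans (cong (count p) (words-suc L)) (count-cartesianProductWith p _∷_ (λ x → x) (words G L))

module VertexCycles {n : ℕ} (G : Graph n) where
  open Walks G
  open Words G

  startsAt : Fin n → List (Fin n) → Bool
  startsAt v []      = false
  startsAt v (x ∷ _) = ⌊ x ≟ v ⌋

  startsWithEdge≤startsAt : ∀ v s →
    sum (λ u → indicator (startsWithEdge G v u s)) ≤ indicator (startsAt v s)
  startsWithEdge≤startsAt v []          = ≤-reflexive (sum-replicate-zero n)
  startsWithEdge≤startsAt v (x ∷ [])    = ≤-trans (≤-reflexive (sum-replicate-zero n)) z≤n
  startsWithEdge≤startsAt v (x ∷ y ∷ s) with x ≟ v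
  ... | yes _ = ≤-reflexive (sum-indicator-≟ y)
  ... | no  _ = ≤-reflexive (sum-replicate-zero n)

  reverseCycle : List (Fin n) → List (Fin n)
  reverseCycle []      = []
  reverseCycle (x ∷ s) = x ∷ reverse s

  reverseCycle-injective : ∀ {s s′} → reverseCycle s ≡ reverseCycle s′ → s ≡ s′
  reverseCycle-injective {[]}    {[]}     _ = refl
  reverseCycle-injective {x ∷ s} {x′ ∷ s′} e =
    cong₂ _∷_ (∷-injectiveˡ e) (reverse-injective (∷-injectiveʳ e))

  length-reverseCycle : ∀ s → length (reverseCycle s) ≡ length s
  length-reverseCycle []      = refl
  length-reverseCycle (x ∷ s) = cong suc (length-reverse s)

  reverse-∷-lastOr : ∀ y s → Σ (List (Fin n)) λ rest →
    reverse (y ∷ s) ≡ lastOr G y s ∷ rest × lastOr G (lastOr G y s) rest ≡ y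
  reverse-∷-lastOr y []      = [] , refl , refl
  reverse-∷-lastOr y (z ∷ s) with reverse-∷-lastOr z s
  ... | rest , rev≡ , last≡ =
    rest ++ [ y ] , trans (unfold-reverse y (z ∷ s)) (cong (_++ [ y ]) rev≡) , lastOr-++ (lastOr G z s) rest y []

  canonicalAt-reverseCycle : ∀ v s → canonicalAt G v s ≡ true → canonicalAt G v (reverseCycle s) ≡ false
  canonicalAt-reverseCycle v (x ∷ y ∷ s) canonical with reverse-∷-lastOr y s
  ... | rest , rev≡ , last≡ rewrite rev≡ | last≡ =
    trans (cong (⌊ x ≟ v ⌋ ∧_) (<ᵇ-asym (toℕ y) (toℕ (lastOr G y s)) (∧-true⁻ʳ {⌊ x ≟ v ⌋} canonical)))
          (∧-zeroʳ _)

  IsCycle-reverseCycle : ∀ s → IsCycle s → IsCycle (reverseCycle s)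
  IsCycle-reverseCycle []       cycle with IsCycle.length≥3 cycle
  ... | ()
  IsCycle-reverseCycle (x ∷ []) cycle with IsCycle.length≥3 cycle
  ... | s≤s ()
  IsCycle-reverseCycle (x ∷ y ∷ s) cycle = record
    { length≥3 = subst (3 ≤_) (sym (length-reverseCycle (x ∷ y ∷ s))) length≥3
    ; unique   = All≢-reverse (y ∷ s) (head unique) ∷ Unique-reverse (y ∷ s) (tail unique)
    ; walk     = subst IsWalk (reverse-++ (y ∷ s) [ x ])
                   (walk-reverse ((y ∷ s) ++ [ x ]) (walk-∷ʳ y s x (walk-tail x (y ∷ s) walk) closed))
    ; closed   = closed′
    }
    where
    open IsCycle cycle
    closed′ : closes G (x ∷ reverse (y ∷ s)) ≡ true
    closed′ with reverse-∷-lastOr y s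
    ... | rest , rev≡ , last≡ rewrite rev≡ | last≡ = ~-sym (∧-true⁻ˡ walk)

  startsAt-reverseCycle : ∀ v s → startsAt v (reverseCycle s) ≡ startsAt v s
  startsAt-reverseCycle v []      = refl
  startsAt-reverseCycle v (x ∷ s) = refl

  canonicalAt⇒startsAt : ∀ v s → canonicalAt G v s ≡ true → startsAt v s ≡ true
  canonicalAt⇒startsAt v (x ∷ y ∷ s) canonical = ∧-true⁻ˡ canonical

  ∈-cycleSeqs-reverseCycle : ∀ L {s} → s ∈ cycleSeqs G L → reverseCycle s ∈ cycleSeqs G L
  ∈-cycleSeqs-reverseCycle L {s} s∈ with ∈-filterᵇ⁻ (isCycleSeq G) (words G L) s∈
  ... | s∈words , is-cycle = ∈-filterᵇ⁺ (isCycleSeq G) (words G L)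
    (subst (λ l → reverseCycle s ∈ words G l) (trans (length-reverseCycle s) (∈-words⁻ L s∈words))
      (∈-words⁺ (reverseCycle s)))
    (IsCycle⇒isCycleSeq (reverseCycle s) (IsCycle-reverseCycle s (isCycleSeq⇒IsCycle s is-cycle)))

  length-∈-cycleSeqs : ∀ L {s} → s ∈ cycleSeqs G L → length s ≡ L
  length-∈-cycleSeqs L s∈ = ∈-words⁻ L (proj₁ (∈-filterᵇ⁻ (isCycleSeq G) (words G L) s∈))

  cycleSeqs-unique : ∀ L → Unique (cycleSeqs G L)
  cycleSeqs-unique L = Unique.filter⁺ _ (words-unique L)

  2*vertexCycleCount≤count-startsAt : ∀ v L → 2 * vertexCycleCount G L v ≤ count (startsAt v) (cycleSeqs G L)
  2*vertexCycleCount≤count-startsAt v L = subst (_≤ count (startsAt v) cycles) length-both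
    (length-≤-injection (λ s → s) both (filterᵇ (startsAt v) cycles) unique-both ⊆-startsAt (λ _ _ e → e))
    where
    cycles    = cycleSeqs G L
    canonical = filterᵇ (canonicalAt G v) cycles
    both      = canonical ++ map reverseCycle canonical

    ∈-canonical⁻ : ∀ {s} → s ∈ canonical → s ∈ cycles × canonicalAt G v s ≡ true
    ∈-canonical⁻ = ∈-filterᵇ⁻ (canonicalAt G v) cycles

    length-both : length both ≡ 2 * length canonical
    length-both = trans (length-++ canonical)
      (cong (length canonical +_) (trans (length-map reverseCycle canonical) (sym (+-identityʳ _))))

    unique-canonical : Unique canonical
    unique-canonical = Unique.filter⁺ _ (cycleSeqs-unique L)

    disjoint : Disjoint canonical (map reverseCycle canonical)
    disjoint (t∈ , t∈rev) with ∈-map⁻ reverseCycle t∈rev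
    ... | s , s∈ , refl
      with trans (sym (canonicalAt-reverseCycle v s (proj₂ (∈-canonical⁻ s∈)))) (proj₂ (∈-canonical⁻ t∈))
    ... | ()

    unique-both : Unique both
    unique-both = Unique.++⁺ unique-canonical (Unique.map⁺ reverseCycle-injective unique-canonical) disjoint

    ⊆-startsAt : ∀ {t} → t ∈ both → t ∈ filterᵇ (startsAt v) cycles
    ⊆-startsAt {t} t∈ with ∈-++⁻ canonical t∈
    ... | inj₁ t∈can =
      let t∈cycles , can = ∈-canonical⁻ t∈can in
      ∈-filterᵇ⁺ (startsAt v) cycles t∈cycles (canonicalAt⇒startsAt v t can)
    ... | inj₂ t∈rev with ∈-map⁻ reverseCycle t∈rev
    ...   | s , s∈ , refl =
      let s∈cycles , can = ∈-canonical⁻ s∈ in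
      ∈-filterᵇ⁺ (startsAt v) cycles (∈-cycleSeqs-reverseCycle L s∈cycles)
        (trans (startsAt-reverseCycle v s) (canonicalAt⇒startsAt v s can))

module NonBacktracking {n : ℕ} (G : Graph n) where
  open Walks G

  nonBacktrackingFrom : Fin n → Fin n → List (Fin n) → Bool
  nonBacktrackingFrom p c []      = true
  nonBacktrackingFrom p c (x ∷ t) = (adj G c x ∧ not ⌊ x ≟ p ⌋) ∧ nonBacktrackingFrom c x t

  -- w ∷ t encodes the non-backtracking walk w, v, t₁, …, tₘ through v
  nonBacktrackingVia : Fin n → List (Fin n) → Bool
  nonBacktrackingVia v []      = false
  nonBacktrackingVia v (w ∷ t) = adj G v w ∧ nonBacktrackingFrom w v t

  path⇒nonBacktrackingFrom : ∀ p c x t → x ≢ p → IsWalk (c ∷ x ∷ t) → Unique (c ∷ x ∷ t) →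
    nonBacktrackingFrom p c (x ∷ t) ≡ true
  path⇒nonBacktrackingFrom p c x []      x≢p walk _ =
    ∧-true⁺ (∧-true⁺ (walk-head c x [] walk) (cong not (≢⇒≟≡false x≢p))) refl
  path⇒nonBacktrackingFrom p c x (y ∷ t) x≢p walk unique@(_ ∷ x∉ ∷ _) =
    ∧-true⁺ (∧-true⁺ (walk-head c x (y ∷ t) walk) (cong not (≢⇒≟≡false x≢p)))
      (path⇒nonBacktrackingFrom c x y t (λ y≡c → All.lookup (head unique) (there (here refl)) (sym y≡c))
        (walk-tail c (x ∷ y ∷ t) walk) (tail unique))

module Regular {n : ℕ} (G : Graph n) {k : ℕ} (regular : IsRegular G k) where
  open Walks G
  open Words G
  open VertexCycles G
  open NonBacktracking G

  degree≡sum : ∀ v → sum (λ x → indicator (adj G v x)) ≡ k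
  degree≡sum v = trans (sym (count-tabulate (adj G v) (λ x → x))) (regular v)

  other-neighbours : ∀ p c → p ~ c → sum (λ x → indicator (adj G c x ∧ not ⌊ x ≟ p ⌋)) ≤ k ∸ 1
  other-neighbours p c p~c = ∸-monoˡ-≤ 1
    (subst (suc (sum (λ x → indicator (adj G c x ∧ not ⌊ x ≟ p ⌋))) ≤_) (degree≡sum c)
      (sum-indicator-remove (adj G c) p (~-sym p~c)))

  count-nonBacktrackingFrom : ∀ m p c → p ~ c → count (nonBacktrackingFrom p c) (words G m) ≤ (k ∸ 1) ^ m
  count-nonBacktrackingFrom zero    p c _   = ≤-refl
  count-nonBacktrackingFrom (suc m) p c p~c = begin
    count (nonBacktrackingFrom p c) (words G (suc m))
      ≡⟨ count-words-suc (nonBacktrackingFrom p c) m ⟩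
    sum (λ x → count (λ t → step x ∧ nonBacktrackingFrom c x t) (words G m))
      ≡⟨ sum-cong-≗ (λ x → count-∧ˡ (step x) (nonBacktrackingFrom c x) (words G m)) ⟩
    sum (λ x → if step x then count (nonBacktrackingFrom c x) (words G m) else 0)
      ≤⟨ sum-guarded-≤ step _ _ (λ x s → count-nonBacktrackingFrom m c x (∧-true⁻ˡ s)) ⟩
    sum (λ x → indicator (step x)) * (k ∸ 1) ^ m
      ≤⟨ *-monoˡ-≤ ((k ∸ 1) ^ m) (other-neighbours p c p~c) ⟩
    (k ∸ 1) ^ suc m
      ∎
    where
    open ≤-Reasoning
    step : Fin n → Bool
    step x = adj G c x ∧ not ⌊ x ≟ p ⌋

  count-nonBacktrackingVia : ∀ v m → count (nonBacktrackingVia v) (words G (suc m)) ≤ k * (k ∸ 1) ^ m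
  count-nonBacktrackingVia v m = begin
    count (nonBacktrackingVia v) (words G (suc m))
      ≡⟨ count-words-suc (nonBacktrackingVia v) m ⟩
    sum (λ w → count (λ t → adj G v w ∧ nonBacktrackingFrom w v t) (words G m))
      ≡⟨ sum-cong-≗ (λ w → count-∧ˡ (adj G v w) (nonBacktrackingFrom w v) (words G m)) ⟩
    sum (λ w → if adj G v w then count (nonBacktrackingFrom w v) (words G m) else 0)
      ≤⟨ sum-guarded-≤ (adj G v) _ _ (λ w v~w → count-nonBacktrackingFrom m w v (~-sym v~w)) ⟩
    sum (λ w → indicator (adj G v w)) * (k ∸ 1) ^ m
      ≡⟨ cong (_* (k ∸ 1) ^ m) (degree≡sum v) ⟩
    k * (k ∸ 1) ^ m
      ∎
    where open ≤-Reasoning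

  k*λ≤count-startsAt : ∀ {g lam} → EdgeGirthRegularCount G g lam → ∀ v →
    k * lam ≤ count (startsAt v) (cycleSeqs G g)
  k*λ≤count-startsAt {g} {lam} edge-regular v = begin
    k * lam
      ≡⟨ cong (_* lam) (degree≡sum v) ⟨
    sum (λ u → indicator (adj G v u)) * lam
      ≤⟨ sum-guarded-≥ (adj G v) (edgeCycleCount G g v) lam (λ u v~u → ≤-reflexive (sym (edge-regular v u v~u)))
       ⟩
    sum (λ u → count (startsWithEdge G v u) (cycleSeqs G g))
      ≤⟨ sum-count-≤ (startsWithEdge G v) (startsAt v) (startsWithEdge≤startsAt v) (cycleSeqs G g) ⟩
    count (startsAt v) (cycleSeqs G g)
      ∎
    where open ≤-Reasoning

2*h+1≡h+suc-h : ∀ h → 2 * h + 1 ≡ h + suc h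
2*h+1≡h+suc-h = solve-∀

module ShortCycles {n : ℕ} (G : Graph n) {h : ℕ} (girth : Cycles.GirthAtLeast G (2 * h + 1)) (v : Fin n) where
  open Walks G
  open Words G
  open Cycles G
  open VertexCycles G
  open NonBacktracking G

  record ShortCycleAt (r : List (Fin n)) : Set where
    field
      cycle : IsCycle (v ∷ r)
      long  : h < length r
      short : length r ≤ 2 * h + 1
  open ShortCycleAt

  ShortCycleSeq : List (Fin n) → Set
  ShortCycleSeq t = Σ (List (Fin n)) λ r → t ≡ v ∷ r × ShortCycleAt r

  walksVia : List (List (Fin n))
  walksVia = filterᵇ (nonBacktrackingVia v) (words G (suc (suc h)))

  -- sends the cycle x, r₁, …, r_L to the walk r_L, x, r₁, …, r_(h+1)
  window : List (Fin n) → List (Fin n)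
  window []      = []
  window (x ∷ r) = lastOr G x r ∷ take (suc h) r

  window-nonBacktracking : ∀ {t} → ShortCycleSeq t → window t ∈ walksVia
  window-nonBacktracking ([] , refl , c) with IsCycle.length≥3 (cycle c)
  ... | s≤s ()
  window-nonBacktracking (x ∷ r , refl , c) = ∈-filterᵇ⁺ (nonBacktrackingVia v) (words G (suc (suc h)))
    (subst (λ l → window (v ∷ x ∷ r) ∈ words G l) length-window (∈-words⁺ (window (v ∷ x ∷ r))))
    (∧-true⁺ (~-sym closed)
      (path⇒nonBacktrackingFrom (lastOr G x r) v x (take h r) (x≢last r length≥3 unique)
        (walk-take (suc (suc h)) (v ∷ x ∷ r) walk) (Unique.take⁺ (suc (suc h)) unique)))
    where
    open IsCycle (cycle c)
    length-window : length (window (v ∷ x ∷ r)) ≡ suc (suc h)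
    length-window = cong (λ l → suc (suc l)) (trans (length-take h r) (m≤n⇒m⊓n≡m (≤-pred (long c))))
    x≢last : ∀ r → 3 ≤ length (v ∷ x ∷ r) → Unique (v ∷ x ∷ r) → x ≢ lastOr G x r
    x≢last []      (s≤s (s≤s ()))
    x≢last (y ∷ r) _ (_ ∷ x∉ ∷ _) x≡last = All.lookup x∉ (lastOr-∈ y r) x≡last

  length-suffix≤h : ∀ (pre : List (Fin n)) z p → length pre ≡ h → length (pre ++ z ∷ p) ≤ 2 * h + 1 →
    length p ≤ h
  length-suffix≤h pre z p |pre| short = ≤-pred (+-cancelˡ-≤ h (suc (length p)) (suc h)
    (subst₂ _≤_ (trans (length-++ pre) (cong (_+ suc (length p)) |pre|)) (2*h+1≡h+suc-h h) short))

  window-injective : ∀ {t t′} → ShortCycleSeq t → ShortCycleSeq t′ → window t ≡ window t′ → t ≡ t′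
  window-injective (r , refl , c) (r′ , refl , c′) same-window
    with splitAt-view h r (long c) | splitAt-view h r′ (long c′)
  ... | pre , z , p , refl , |pre| | pre′ , z′ , p′ , refl , |pre′|
    with ∷ʳ-injective pre pre′ (trans (sym (take-suc-++ pre z p |pre|))
                                (trans (∷-injectiveʳ same-window) (take-suc-++ pre′ z′ p′ |pre′|)))
  ... | refl , refl = cong (λ q → v ∷ pre ++ z ∷ q)
    (paths-unique-below-girth girth z p p′ (suffix-unique c) (suffix-unique c′) (suffix-walk c) (suffix-walk c′)
      same-end short-paths)
    where
    suffix-unique : ∀ {q} → ShortCycleAt (pre ++ z ∷ q) → Unique (z ∷ q)
    suffix-unique c = Unique-++⁻ʳ (v ∷ pre) (IsCycle.unique (cycle c))
    suffix-walk : ∀ {q} → ShortCycleAt (pre ++ z ∷ q) → IsWalk (z ∷ q)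
    suffix-walk c = walk-++⁻ʳ (v ∷ pre) z _ (IsCycle.walk (cycle c))
    same-end : lastOr G z p ≡ lastOr G z p′
    same-end = trans (sym (lastOr-++ v pre z p)) (trans (∷-injectiveˡ same-window) (lastOr-++ v pre z p′))
    short-paths : length p + length p′ < 2 * h + 1
    short-paths = subst (suc (length p + length p′) ≤_) (trans (sym (+-suc h h)) (sym (2*h+1≡h+suc-h h)))
      (s≤s (+-mono-≤ (length-suffix≤h pre z p |pre| (short c)) (length-suffix≤h pre z p′ |pre′| (short c′))))

  ∈-startsAt⇒ShortCycleSeq : ∀ {L t} → suc h < L → L ≤ suc (2 * h + 1) →
    t ∈ filterᵇ (startsAt v) (cycleSeqs G L) → ShortCycleSeq t
  ∈-startsAt⇒ShortCycleSeq {L} {[]} _ _ t∈ with proj₂ (∈-filterᵇ⁻ (startsAt v) (cycleSeqs G L) t∈)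
  ... | ()
  ∈-startsAt⇒ShortCycleSeq {L} {x ∷ r} lo hi t∈ with ∈-filterᵇ⁻ (startsAt v) (cycleSeqs G L) t∈
  ... | t∈cycles , starts with ∈-filterᵇ⁻ (isCycleSeq G) (words G L) t∈cycles | ≟≡true⇒≡ starts
  ... | _ , is-cycle | refl = r , refl , record
    { cycle = isCycleSeq⇒IsCycle (v ∷ r) is-cycle
    ; long  = ≤-pred (subst (suc (suc h) ≤_) (sym length≡) lo)
    ; short = ≤-pred (subst (_≤ suc (2 * h + 1)) (sym length≡) hi)
    }
    where
    length≡ : suc (length r) ≡ L
    length≡ = length-∈-cycleSeqs L t∈cycles

  count-startsAt≤count-nonBacktrackingVia : 1 ≤ h →
    count (startsAt v) (cycleSeqs G (suc (2 * h + 1))) + count (startsAt v) (cycleSeqs G (2 * h + 1))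
      ≤ count (nonBacktrackingVia v) (words G (suc (suc h)))
  count-startsAt≤count-nonBacktrackingVia h≥1 = subst (_≤ length walksVia) (length-++ longer)
    (length-≤-injection window (longer ++ shorter) walksVia unique
      (λ t∈ → window-nonBacktracking (short-cycle t∈))
      (λ t∈ t′∈ → window-injective (short-cycle t∈) (short-cycle t′∈)))
    where
    cyclesAt : ℕ → List (List (Fin n))
    cyclesAt L = filterᵇ (startsAt v) (cycleSeqs G L)
    longer  = cyclesAt (suc (2 * h + 1))
    shorter = cyclesAt (2 * h + 1)

    suc-h<g : suc h < 2 * h + 1
    suc-h<g = subst (suc (suc h) ≤_) (sym (2*h+1≡h+suc-h h)) (+-monoˡ-≤ (suc h) h≥1)

    short-cycle : ∀ {t} → t ∈ longer ++ shorter → ShortCycleSeq t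
    short-cycle t∈ with ∈-++⁻ longer t∈
    ... | inj₁ t∈longer  = ∈-startsAt⇒ShortCycleSeq (s≤s (<⇒≤ suc-h<g)) ≤-refl t∈longer
    ... | inj₂ t∈shorter = ∈-startsAt⇒ShortCycleSeq suc-h<g (n≤1+n _) t∈shorter

    length-∈ : ∀ L {t} → t ∈ cyclesAt L → length t ≡ L
    length-∈ L t∈ = length-∈-cycleSeqs L (proj₁ (∈-filterᵇ⁻ (startsAt v) (cycleSeqs G L) t∈))

    unique-cyclesAt : ∀ L → Unique (cyclesAt L)
    unique-cyclesAt L = Unique.filter⁺ _ (cycleSeqs-unique L)

    unique : Unique (longer ++ shorter)
    unique = Unique.++⁺ (unique-cyclesAt (suc (2 * h + 1))) (unique-cyclesAt (2 * h + 1))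
      (λ (t∈longer , t∈shorter) →
        1+n≢n (trans (sym (length-∈ (suc (2 * h + 1)) t∈longer)) (length-∈ (2 * h + 1) t∈shorter)))

2*[k]C2≡k*[k∸1] : ∀ k → 2 * (k C 2) ≡ k * (k ∸ 1)
2*[k]C2≡k*[k∸1] zero          = refl
2*[k]C2≡k*[k∸1] (suc zero)    = refl
2*[k]C2≡k*[k∸1] (suc (suc m)) = begin
  2 * (suc (suc m) C 2)         ≡⟨ cong (2 *_) (nCk+nC[k+1]≡[n+1]C[k+1] (suc m) 1) ⟨
  2 * (suc m C 1 + suc m C 2)   ≡⟨ cong (λ c → 2 * (c + suc m C 2)) (nC1≡n (suc m)) ⟩
  2 * (suc m + suc m C 2)       ≡⟨ *-distribˡ-+ 2 (suc m) (suc m C 2) ⟩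
  2 * suc m + 2 * (suc m C 2)   ≡⟨ cong (2 * suc m +_) (2*[k]C2≡k*[k∸1] (suc m)) ⟩
  2 * suc m + suc m * m         ≡⟨ step m ⟩
  suc (suc m) * suc m           ∎
  where
  open ≡-Reasoning
  step : ∀ m → 2 * suc m + suc m * m ≡ suc (suc m) * suc m
  step = solve-∀

rescale-by-[k∸1]/2 : ∀ k c lam P → 2 * c + k * lam ≤ k * P → c * (k ∸ 1) + (k C 2) * lam ≤ (k C 2) * P
rescale-by-[k∸1]/2 k c lam P bound = *-cancelˡ-≤ 2 (begin
  2 * (c * (k ∸ 1) + (k C 2) * lam)      ≡⟨ distribute c (k ∸ 1) (k C 2) lam ⟩
  (k ∸ 1) * (2 * c) + 2 * (k C 2) * lam  ≡⟨ cong (λ x → (k ∸ 1) * (2 * c) + x * lam) (2*[k]C2≡k*[k∸1] k) ⟩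
  (k ∸ 1) * (2 * c) + k * (k ∸ 1) * lam  ≡⟨ factor (k ∸ 1) c k lam ⟩
  (k ∸ 1) * (2 * c + k * lam)            ≤⟨ *-monoʳ-≤ (k ∸ 1) bound ⟩
  (k ∸ 1) * (k * P)                      ≡⟨ swap (k ∸ 1) k P ⟩
  k * (k ∸ 1) * P                        ≡⟨ cong (_* P) (2*[k]C2≡k*[k∸1] k) ⟨
  2 * (k C 2) * P                        ≡⟨ *-assoc 2 (k C 2) P ⟩
  2 * ((k C 2) * P)                      ∎)
  where
  open ≤-Reasoning
  distribute : ∀ c K C lam → 2 * (c * K + C * lam) ≡ K * (2 * c) + 2 * C * lam
  distribute = solve-∀
  factor : ∀ K c k lam → K * (2 * c) + k * K * lam ≡ K * (2 * c + k * lam)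
  factor = solve-∀
  swap : ∀ K k P → K * (k * P) ≡ k * K * P
  swap = solve-∀

girth≥3⇒h≥1 : ∀ h → 3 ≤ 2 * h + 1 → 1 ≤ h
girth≥3⇒h≥1 zero    (s≤s ())
girth≥3⇒h≥1 (suc h) _ = s≤s z≤n

mainTheorem12 : ∀ {n k g lam h : ℕ} (G : Graph n) → 3 ≤ k → IsEGR G k g lam →
    g ≡ 2 * h + 1 → (v : Fin n) →
    vertexCycleCount G (suc g) v * (k ∸ 1) + (k C 2) * lam ≤ (k C 2) * (k ∸ 1) ^ (suc h)
mainTheorem12 {k = k} {lam = lam} {h} G _ (regular , ((s , length-s , s-cycle) , girth) , edge-regular) refl v =
  rescale-by-[k∸1]/2 k (vertexCycleCount G (suc g) v) lam ((k ∸ 1) ^ suc h) (begin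
    2 * vertexCycleCount G (suc g) v + k * lam
      ≤⟨ +-mono-≤ (2*vertexCycleCount≤count-startsAt v (suc g)) (k*λ≤count-startsAt {g} edge-regular v) ⟩
    count (startsAt v) (cycleSeqs G (suc g)) + count (startsAt v) (cycleSeqs G g)
      ≤⟨ count-startsAt≤count-nonBacktrackingVia h≥1 ⟩
    count (nonBacktrackingVia v) (words G (suc (suc h)))
      ≤⟨ count-nonBacktrackingVia v (suc h) ⟩
    k * (k ∸ 1) ^ suc h
      ∎)
  where
  open ≤-Reasoning
  open Walks G
  open VertexCycles G
  open NonBacktracking G
  open Regular G regular
  open ShortCycles G {h} girth v
  g = 2 * h + 1
  h≥1 : 1 ≤ h
  h≥1 = girth≥3⇒h≥1 h (subst (3 ≤_) length-s (IsCycle.length≥3 (isCycleSeq⇒IsCycle s s-cycle)))
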